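{- Let $n\ge 1$ and let $a_1,\dots,a_n$ be nonnegative integers. Let $F=\bigcup_{i=1}^n a_iP_i$ be the linear forest that is the disjoint union of $a_i$ copies of the path $P_i$ for each $i\in\{1,\dots,n\}$. If $\sum_{i=2}^n a_i\ge 2$, then $\Theta(F)=2$.
   Context: $P_i$ denotes the path on $i$ vertices. For an integer $k\ge 0$, a graph $G=(V,E)$ is a $k$-threshold graph with thresholds $\theta_1<\dots<\theta_k$ if there is $r:V\to\mathbb{R}$ such that for any two distinct $u,v\in V$, $uv\in E$ if and only if $r(u)+r(v)\ge\theta_i$ for an odd number of indices $i\in\{1,\dots,k\}$. The threshold number $\Theta(G)$ is the smallest $k\ge 0$ such that $G$ is a $k$-threshold graph.
   Formalization: The ranks r and the thresholds take values in ℚ instead of ℝ. -}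

module Defs where

open import Data.Nat as N using (ℕ; zero; suc; _%_; _+_)
open import Data.Fin as Fin using (Fin; zero; suc; toℕ)
open import Data.Rational as ℚ using (ℚ)
open import Data.Product using (Σ; ∃; _×_; _,_)
open import Data.Sum using (_⊎_)
open import Data.Bool using (if_then_else_)
open import Relation.Nullary using (¬_)
open import Relation.Nullary.Decidable using (⌊_⌋)
open import Relation.Binary.PropositionalEquality using (_≡_; _≢_)
open import Function using (_∘_; _⇔_)

record Graph : Set₁ where
  field
    V : Set
    E : V → V → Set
open Graph public

countLE : ∀ {k} → (Fin k → ℚ) → ℚ → ℕ
countLE {zero}  θ s = 0
countLE {suc k} θ s = (if ⌊ θ zero ℚ.≤? s ⌋ then 1 else 0) + countLE (θ ∘ suc) s

IsKThreshold : Graph → ℕ → Set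
IsKThreshold G k =
  Σ (Fin k → ℚ) λ θ →
  (∀ (i j : Fin k) → i Fin.< j → θ i ℚ.< θ j) ×
  Σ (V G → ℚ) λ r →
  ∀ (u v : V G) → u ≢ v →
    (E G u v ⇔ (countLE θ (r u ℚ.+ r v) % 2 ≡ 1))

ThresholdNumberIs : Graph → ℕ → Set
ThresholdNumberIs G k = IsKThreshold G k × (∀ m → m N.< k → ¬ IsKThreshold G m)

∑ : (n : ℕ) → (Fin n → ℕ) → ℕ
∑ zero    f = 0
∑ (suc n) f = f zero + ∑ n (f ∘ suc)

-- Linear forest ⋃ a_i P_i with n path lengths: index i : Fin n stands for
-- the path P_{toℕ i + 1}; a i is the number of its copies.
-- Vertex (i , j , p): path length toℕ i + 1, copy j, position p on the path.
LFVertex : (n : ℕ) → (Fin n → ℕ) → Set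
LFVertex n a = Σ (Fin n) λ i → Fin (a i) × Fin (suc (toℕ i))

LFEdge : (n : ℕ) (a : Fin n → ℕ) → LFVertex n a → LFVertex n a → Set
LFEdge n a (i , j , p) (i' , j' , p') =
  toℕ i ≡ toℕ i' × toℕ j ≡ toℕ j' ×
  (suc (toℕ p) ≡ toℕ p' ⊎ suc (toℕ p') ≡ toℕ p)

linearForest : (n : ℕ) → (Fin n → ℕ) → Graph
linearForest n a = record { V = LFVertex n a ; E = LFEdge n a }

{-# OPTIONS --safe #-}
module Submission where

-- Lay the forest out on ℕ, each path on consecutive integers and distinct paths separated by
-- gaps; this makes it an induced subgraph of the infinite path on ℕ. That path is 2-threshold:
-- with rank (-1)^t (t + 1) at t, the rank sum of t and t' lies in [-1, 2) exactly when
-- |t - t'| = 1. Conversely a 0-threshold graph has no edges, and a 1-threshold graph has no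
-- induced 2K₂, while the first edges of two paths with at least two vertices form one.

open import Defs
open import Data.Nat using (ℕ; suc; _≤_)
open import Data.Fin using (Fin; suc)
open import Function using (_∘_)

open import Algebra.Bundles using (CommutativeMonoid)
import Algebra.Properties.CommutativeSemigroup as CommSemigroupProperties
open import Data.Fin as Fin using (zero; toℕ; fromℕ<)
import Data.Fin.Properties as FinP
open import Data.Integer as ℤ using (ℤ; +_; _⊖_; _◃_; -1ℤ)
import Data.Integer.Properties as ℤP
open import Data.Nat as ℕ using (zero; s≤s; z≤n; _+_; _*_; _%_; _<_)
open import Data.Nat.DivMod using ([m+kn]%n≡m%n; m<n⇒m%n≡m)
import Data.Nat.Properties as ℕP
open import Data.Product using (Σ; _×_; _,_; proj₁; proj₂)
import Data.Product as Product
open import Data.Rational as ℚ using (ℚ)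
open import Data.Rational.Literals using (fromℤ)
import Data.Rational.Properties as ℚP
import Data.Rational.Unnormalised as ℚᵘ
import Data.Rational.Unnormalised.Properties as ℚᵘP
open import Data.Sign as Sign using (Sign; opposite)
open import Data.Sum as Sum using (_⊎_; inj₁; inj₂)
open import Function.Bundles using (Equivalence; _⇔_; mk⇔)
open import Function.Properties.Equivalence using () renaming (trans to ⇔-trans; sym to ⇔-sym)
open import Relation.Nullary using (¬_; yes; no; contradiction)
open import Relation.Binary.PropositionalEquality

open Equivalence using (to; from)

fromℤ-homo-+ : ∀ x y → fromℤ (x ℤ.+ y) ≡ fromℤ x ℚ.+ fromℤ y
fromℤ-homo-+ x y = sym (ℚP.toℚᵘ-injective (ℚᵘP.≃-trans
  (ℚP.toℚᵘ-homo-+ (fromℤ x) (fromℤ y))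
  (ℚᵘ.*≡* (cong (ℤ._* ℤ.1ℤ) (cong₂ ℤ._+_ (ℤP.*-identityʳ x) (ℤP.*-identityʳ y))))))

fromℤ-mono-≤ : ∀ {x y} → x ℤ.≤ y → fromℤ x ℚ.≤ fromℤ y
fromℤ-mono-≤ {x} {y} x≤y =
  ℚ.*≤* (subst₂ ℤ._≤_ (sym (ℤP.*-identityʳ x)) (sym (ℤP.*-identityʳ y)) x≤y)

fromℤ-cancel-≤ : ∀ {x y} → fromℤ x ℚ.≤ fromℤ y → x ℤ.≤ y
fromℤ-cancel-≤ {x} {y} (ℚ.*≤* x≤y) =
  subst₂ ℤ._≤_ (ℤP.*-identityʳ x) (ℤP.*-identityʳ y) x≤y

fromℤ-mono-< : ∀ {x y} → x ℤ.< y → fromℤ x ℚ.< fromℤ y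
fromℤ-mono-< {x} {y} x<y =
  ℚ.*<* (subst₂ ℤ._<_ (sym (ℤP.*-identityʳ x)) (sym (ℤP.*-identityʳ y)) x<y)

fromℤ-cancel-< : ∀ {x y} → fromℤ x ℚ.< fromℤ y → x ℤ.< y
fromℤ-cancel-< {x} {y} (ℚ.*<* x<y) =
  subst₂ ℤ._<_ (ℤP.*-identityʳ x) (ℤP.*-identityʳ y) x<y

oneThreshold-odd⇔ : (θ : Fin 1 → ℚ) (s : ℚ) → countLE θ s % 2 ≡ 1 ⇔ θ zero ℚ.≤ s
oneThreshold-odd⇔ θ s with θ zero ℚ.≤? s
... | yes θ₀≤s = mk⇔ (λ _ → θ₀≤s) (λ _ → refl)
... | no θ₀≰s = mk⇔ (λ ()) (λ θ₀≤s → contradiction θ₀≤s θ₀≰s)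

twoThresholds-odd⇔ : (θ : Fin 2 → ℚ) → θ zero ℚ.< θ (suc zero) → (s : ℚ) →
  countLE θ s % 2 ≡ 1 ⇔ (θ zero ℚ.≤ s × s ℚ.< θ (suc zero))
twoThresholds-odd⇔ θ θ₀<θ₁ s with θ zero ℚ.≤? s | θ (suc zero) ℚ.≤? s
... | yes θ₀≤s | no θ₁≰s = mk⇔ (λ _ → θ₀≤s , ℚP.≰⇒> θ₁≰s) (λ _ → refl)
... | yes _    | yes θ₁≤s =
  mk⇔ (λ ()) (λ (_ , s<θ₁) → contradiction (ℚP.<-≤-trans s<θ₁ θ₁≤s) (ℚP.<-irrefl refl))
... | no θ₀≰s  | yes θ₁≤s = contradiction (ℚP.≤-trans (ℚP.<⇒≤ θ₀<θ₁) θ₁≤s) θ₀≰s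
... | no θ₀≰s  | no _ = mk⇔ (λ ()) (λ (θ₀≤s , _) → contradiction θ₀≤s θ₀≰s)

IsKThreshold-induced : ∀ {G H : Graph} {k} (f : V G → V H) → (∀ {u v} → f u ≡ f v → u ≡ v) →
  (∀ u v → E G u v ⇔ E H (f u) (f v)) → IsKThreshold H k → IsKThreshold G k
IsKThreshold-induced f f-injective f-induced (θ , θ-increasing , r , r-represents) =
  θ , θ-increasing , r ∘ f ,
  λ u v u≢v → ⇔-trans (f-induced u v) (r-represents (f u) (f v) (u≢v ∘ f-injective))

IsKThreshold-0⇒edgeless : ∀ {G : Graph} → IsKThreshold G 0 → ∀ {u v} → u ≢ v → ¬ E G u v
IsKThreshold-0⇒edgeless (_ , _ , _ , represents) u≢v uv with to (represents _ _ u≢v) uv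
... | ()

IsKThreshold-1⇒2K₂-free : ∀ {G : Graph} → IsKThreshold G 1 → ∀ {u w u' w'} →
  u ≢ w → u' ≢ w' → u ≢ u' → w ≢ w' →
  E G u w → E G u' w' → E G u u' ⊎ E G w w'
IsKThreshold-1⇒2K₂-free (θ , _ , r , represents) {u} {w} {u'} {w'} u≢w u'≢w' u≢u' w≢w' uw u'w'
  with θ zero ℚ.≤? r u ℚ.+ r u'
... | yes θ≤uu' = inj₁ (from (represents u u' u≢u') (from (oneThreshold-odd⇔ θ _) θ≤uu'))
... | no θ≰uu' = inj₂ (from (represents w w' w≢w') (from (oneThreshold-odd⇔ θ _) θ≤ww'))
  where
  open CommSemigroupProperties (CommutativeMonoid.commutativeSemigroup ℚP.+-0-commutativeMonoid)
    using (interchange)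
  θ≤uw : θ zero ℚ.≤ r u ℚ.+ r w
  θ≤uw = to (oneThreshold-odd⇔ θ _) (to (represents u w u≢w) uw)
  θ≤u'w' : θ zero ℚ.≤ r u' ℚ.+ r w'
  θ≤u'w' = to (oneThreshold-odd⇔ θ _) (to (represents u' w' u'≢w') u'w')
  -- (r u + r u') + (r w + r w') = (r u + r w) + (r u' + r w') ≥ 2θ,
  -- so the two non-edge sums cannot both lie below θ.
  θ≤ww' : θ zero ℚ.≤ r w ℚ.+ r w'
  θ≤ww' = ℚP.≮⇒≥ λ ww'<θ → ℚP.<-irrefl (interchange (r u) (r u') (r w) (r w'))
    (ℚP.<-≤-trans (ℚP.+-mono-< (ℚP.≰⇒> θ≰uu') ww'<θ) (ℚP.+-mono-≤ θ≤uw θ≤u'w'))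

Adjacent : ℕ → ℕ → Set
Adjacent t t' = suc t ≡ t' ⊎ suc t' ≡ t

ℕ-path : Graph
ℕ-path = record { V = ℕ ; E = Adjacent }

parity : ℕ → Sign
parity zero    = Sign.+
parity (suc t) = opposite (parity t)

alternatingRank : ℕ → ℤ
alternatingRank t = parity t ◃ suc t

InWindow : ℤ → Set
InWindow x = -1ℤ ℤ.≤ x × x ℤ.< + 2

n⊖1+n≡-1 : ∀ n → n ⊖ suc n ≡ -1ℤ
n⊖1+n≡-1 n = trans (ℤP.⊖-< (ℕP.n<1+n n)) (cong (ℤ.-_ ∘ +_) (ℕP.m+n∸n≡m 1 n))

1+n⊖n≡1 : ∀ n → suc n ⊖ n ≡ + 1
1+n⊖n≡1 n = trans (ℤP.⊖-≥ (ℕP.n≤1+n n)) (cong +_ (ℕP.m+n∸n≡m 1 n))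

opposite-signs-window : ∀ s t → InWindow ((s ◃ suc t) ℤ.+ (opposite s ◃ suc (suc t)))
opposite-signs-window Sign.+ t rewrite n⊖1+n≡-1 (suc t) = ℤ.-≤- z≤n , ℤ.-<+
opposite-signs-window Sign.- t rewrite 1+n⊖n≡1 (suc t) = ℤ.-≤+ , ℤ.+<+ (s≤s (s≤s z≤n))

⊖-window⇒near : ∀ t t' → InWindow (t ⊖ t') → t ≡ t' ⊎ Adjacent t t'
⊖-window⇒near zero          zero           _ = inj₁ refl
⊖-window⇒near zero          (suc zero)     _ = inj₂ (inj₁ refl)
⊖-window⇒near zero          (suc (suc _))  (ℤ.-≤- () , _)
⊖-window⇒near (suc zero)    zero           _ = inj₂ (inj₂ refl)
⊖-window⇒near (suc (suc _)) zero           (_ , ℤ.+<+ (s≤s (s≤s ())))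
⊖-window⇒near (suc t)       (suc t')       w
  rewrite ℤP.[1+m]⊖[1+n]≡m⊖n t t' =
    Sum.map (cong suc) (Sum.map (cong suc) (cong suc)) (⊖-window⇒near t t' w)

window⇒opposite-signs-near : ∀ s s' t t' → InWindow ((s ◃ suc t) ℤ.+ (s' ◃ suc t')) →
  s ≢ s' × (t ≡ t' ⊎ Adjacent t t')
window⇒opposite-signs-near Sign.+ Sign.+ t t' (_ , ℤ.+<+ (s≤s (s≤s t+1+t'≤0))) =
  contradiction (ℕP.n≤0⇒n≡0 t+1+t'≤0) (ℕP.m+1+n≢0 t)
window⇒opposite-signs-near Sign.- Sign.- t t' (ℤ.-≤- () , _)
window⇒opposite-signs-near Sign.+ Sign.- t t' w
  rewrite ℤP.[1+m]⊖[1+n]≡m⊖n t t' = (λ ()) , ⊖-window⇒near t t' w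
window⇒opposite-signs-near Sign.- Sign.+ t t' w
  rewrite ℤP.[1+m]⊖[1+n]≡m⊖n t' t = (λ ()) , Sum.map sym Sum.swap (⊖-window⇒near t' t w)

alternatingRank-window⇔adjacent : ∀ t t' →
  InWindow (alternatingRank t ℤ.+ alternatingRank t') ⇔ Adjacent t t'
alternatingRank-window⇔adjacent t t' = mk⇔ window⇒adjacent adjacent⇒window
  where
  window⇒adjacent : InWindow (alternatingRank t ℤ.+ alternatingRank t') → Adjacent t t'
  window⇒adjacent w with window⇒opposite-signs-near (parity t) (parity t') t t' w
  ... | parities-differ , inj₁ refl = contradiction refl parities-differ
  ... | _ , inj₂ adjacent = adjacent
  adjacent⇒window : Adjacent t t' → InWindow (alternatingRank t ℤ.+ alternatingRank t')
  adjacent⇒window (inj₁ refl) = opposite-signs-window (parity t) t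
  adjacent⇒window (inj₂ refl) =
    subst InWindow (ℤP.+-comm (alternatingRank t') (alternatingRank t))
      (opposite-signs-window (parity t') t')

pathThresholds : Fin 2 → ℚ
pathThresholds zero       = fromℤ -1ℤ
pathThresholds (suc zero) = fromℤ (+ 2)

pathThresholds-increasing : ∀ i j → i Fin.< j → pathThresholds i ℚ.< pathThresholds j
pathThresholds-increasing zero       (suc zero) _ = fromℤ-mono-< ℤ.-<+
pathThresholds-increasing zero       zero       ()
pathThresholds-increasing (suc zero) zero       ()
pathThresholds-increasing (suc zero) (suc zero) (s≤s ())

fromℤ-window⇔ : ∀ x → InWindow x ⇔ (fromℤ -1ℤ ℚ.≤ fromℤ x × fromℤ x ℚ.< fromℤ (+ 2))
fromℤ-window⇔ x =
  mk⇔ (Product.map fromℤ-mono-≤ fromℤ-mono-<) (Product.map fromℤ-cancel-≤ fromℤ-cancel-<)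

ℕ-path-IsKThreshold-2 : IsKThreshold ℕ-path 2
ℕ-path-IsKThreshold-2 =
  pathThresholds , pathThresholds-increasing , fromℤ ∘ alternatingRank , represents
  where
  θ₀<θ₁ : pathThresholds zero ℚ.< pathThresholds (suc zero)
  θ₀<θ₁ = pathThresholds-increasing zero (suc zero) (s≤s z≤n)
  represents : ∀ t t' → t ≢ t' →
    Adjacent t t' ⇔
    (countLE pathThresholds (fromℤ (alternatingRank t) ℚ.+ fromℤ (alternatingRank t')) % 2 ≡ 1)
  represents t t' _ rewrite sym (fromℤ-homo-+ (alternatingRank t) (alternatingRank t')) =
    ⇔-trans (⇔-sym (alternatingRank-window⇔adjacent t t')) (⇔-trans (fromℤ-window⇔ _)
      (⇔-sym (twoThresholds-odd⇔ pathThresholds θ₀<θ₁ _)))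

divMod-unique : ∀ {d x y c c'} → x < d → y < d → x + c * d ≡ y + c' * d → x ≡ y × c ≡ c'
divMod-unique {suc d} {x} {y} {c} {c'} x<d y<d eq =
  x≡y , ℕP.*-cancelʳ-≡ c c' (suc d)
          (ℕP.+-cancelˡ-≡ x _ _ (trans eq (cong (_+ c' * suc d) (sym x≡y))))
  where
  open ≡-Reasoning
  x≡y : x ≡ y
  x≡y = begin
    x                        ≡⟨ m<n⇒m%n≡m x<d ⟨
    x % suc d                ≡⟨ [m+kn]%n≡m%n x c (suc d) ⟨
    (x + c * suc d) % suc d  ≡⟨ cong (_% suc d) eq ⟩
    (y + c' * suc d) % suc d ≡⟨ [m+kn]%n≡m%n y c' (suc d) ⟩
    y % suc d                ≡⟨ m<n⇒m%n≡m y<d ⟩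
    y                        ∎

Copy : (n : ℕ) → (Fin n → ℕ) → Set
Copy n b = Σ (Fin n) λ i → Fin (b i)

Copy-≡ : ∀ {n b} {i i' : Fin n} {j : Fin (b i)} {j' : Fin (b i')} →
  toℕ i ≡ toℕ i' → toℕ j ≡ toℕ j' → _≡_ {A = Copy n b} (i , j) (i' , j')
Copy-≡ i≡i' j≡j' with FinP.toℕ-injective i≡i'
... | refl = cong (_ ,_) (FinP.toℕ-injective j≡j')

LFVertex-≡ : ∀ {n a} {i i' : Fin n} {j : Fin (a i)} {j' : Fin (a i')} {p p'} →
  toℕ i ≡ toℕ i' → toℕ j ≡ toℕ j' → toℕ p ≡ toℕ p' →
  _≡_ {A = LFVertex n a} (i , j , p) (i' , j' , p')
LFVertex-≡ {a = a} i≡i' j≡j' p≡p' with Copy-≡ {b = a} i≡i' j≡j'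
... | refl = cong (λ p → _ , _ , p) (FinP.toℕ-injective p≡p')

module _ {n : ℕ} {a : Fin n → ℕ} where

  -- Copy j of the path indexed by i is laid out on the block of suc n consecutive
  -- integers numbered i + j * n; a path has at most n vertices, so blocks never touch.
  layout : LFVertex n a → ℕ
  layout (i , j , p) = toℕ p + (toℕ i + toℕ j * n) * suc n

  position<n : (i : Fin n) (p : Fin (suc (toℕ i))) → toℕ p < n
  position<n i p = ℕP.≤-trans (FinP.toℕ<n p) (FinP.toℕ<n i)

  layout-injective : ∀ {u v} → layout u ≡ layout v → u ≡ v
  layout-injective {i , j , p} {i' , j' , p'} eq
    with divMod-unique (ℕP.m<n⇒m<1+n (position<n i p)) (ℕP.m<n⇒m<1+n (position<n i' p')) eq
  ... | p≡p' , c≡c' with divMod-unique (FinP.toℕ<n i) (FinP.toℕ<n i') c≡c'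
  ... | i≡i' , j≡j' = LFVertex-≡ i≡i' j≡j' p≡p'

  Follows : LFVertex n a → LFVertex n a → Set
  Follows (i , j , p) (i' , j' , p') =
    toℕ i ≡ toℕ i' × toℕ j ≡ toℕ j' × suc (toℕ p) ≡ toℕ p'

  layout-suc⇔ : ∀ u v → suc (layout u) ≡ layout v ⇔ Follows u v
  layout-suc⇔ u@(i , j , p) v@(i' , j' , p') = mk⇔ decode encode
    where
    decode : suc (layout u) ≡ layout v → Follows u v
    decode eq with divMod-unique (s≤s (position<n i p)) (ℕP.m<n⇒m<1+n (position<n i' p')) eq
    ... | p+1≡p' , c≡c' with divMod-unique (FinP.toℕ<n i) (FinP.toℕ<n i') c≡c'
    ... | i≡i' , j≡j' = i≡i' , j≡j' , p+1≡p'
    encode : Follows u v → suc (layout u) ≡ layout v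
    encode (i≡i' , j≡j' , p+1≡p') =
      cong₂ _+_ p+1≡p' (cong (_* suc n) (cong₂ (λ x y → x + y * n) i≡i' j≡j'))

  layout-induced : ∀ u v → LFEdge n a u v ⇔ Adjacent (layout u) (layout v)
  layout-induced u v = mk⇔ edge⇒adjacent adjacent⇒edge
    where
    edge⇒adjacent : LFEdge n a u v → Adjacent (layout u) (layout v)
    edge⇒adjacent (i≡i' , j≡j' , inj₁ p+1≡p') =
      inj₁ (from (layout-suc⇔ u v) (i≡i' , j≡j' , p+1≡p'))
    edge⇒adjacent (i≡i' , j≡j' , inj₂ p'+1≡p) =
      inj₂ (from (layout-suc⇔ v u) (sym i≡i' , sym j≡j' , p'+1≡p))
    adjacent⇒edge : Adjacent (layout u) (layout v) → LFEdge n a u v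
    adjacent⇒edge (inj₁ eq) with to (layout-suc⇔ u v) eq
    ... | i≡i' , j≡j' , p+1≡p' = i≡i' , j≡j' , inj₁ p+1≡p'
    adjacent⇒edge (inj₂ eq) with to (layout-suc⇔ v u) eq
    ... | i'≡i , j'≡j , p'+1≡p = sym i'≡i , sym j'≡j , inj₂ p'+1≡p

linearForest-IsKThreshold-2 : ∀ n a → IsKThreshold (linearForest n a) 2
linearForest-IsKThreshold-2 n a =
  IsKThreshold-induced layout layout-injective layout-induced ℕ-path-IsKThreshold-2

shiftCopy : ∀ {n} {b : Fin (suc n) → ℕ} → Copy n (b ∘ suc) → Copy (suc n) b
shiftCopy (i , j) = suc i , j

shiftCopy-injective : ∀ {n} {b : Fin (suc n) → ℕ} {P Q : Copy n (b ∘ suc)} →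
  shiftCopy {b = b} P ≡ shiftCopy Q → P ≡ Q
shiftCopy-injective {P = i , j} {i' , j'} refl = refl

some-copy : ∀ n (b : Fin n → ℕ) → 1 ≤ ∑ n b → Copy n b
some-copy (suc n) b h with b zero in eq
... | zero  = shiftCopy (some-copy n (b ∘ suc) h)
... | suc _ = zero , fromℕ< (subst (0 <_) (sym eq) (s≤s z≤n))

two-distinct-copies : ∀ n (b : Fin n → ℕ) → 2 ≤ ∑ n b →
  Σ (Copy n b) λ P → Σ (Copy n b) λ Q → P ≢ Q
two-distinct-copies (suc n) b h with b zero in eq
... | zero with two-distinct-copies n (b ∘ suc) h
...   | P , Q , P≢Q = shiftCopy P , shiftCopy Q , P≢Q ∘ shiftCopy-injective
two-distinct-copies (suc n) b (s≤s h) | suc zero =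
  (zero , fromℕ< (subst (0 <_) (sym eq) (s≤s z≤n))) , shiftCopy (some-copy n (b ∘ suc) h) , λ ()
two-distinct-copies (suc n) b h | suc (suc _) =
  (zero , fromℕ< 0<b₀) , (zero , fromℕ< 1<b₀) ,
  λ P≡Q → ℕP.0≢1+n (trans (sym (FinP.toℕ-fromℕ< 0<b₀))
                     (trans (cong (λ P → toℕ (proj₂ P)) P≡Q) (FinP.toℕ-fromℕ< 1<b₀)))
  where
  0<b₀ : 0 < b zero
  0<b₀ = subst (0 <_) (sym eq) (s≤s z≤n)
  1<b₀ : 1 < b zero
  1<b₀ = subst (1 <_) (sym eq) (s≤s (s≤s z≤n))

module _ {m : ℕ} {a : Fin (suc m) → ℕ} where

  -- Copy m (a ∘ suc) indexes the copies of the paths P_i with i ≥ 2,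
  -- each of which has an edge between positions 0 and 1.
  vertexOn : (P : Copy m (a ∘ suc)) → Fin (suc (suc (toℕ (proj₁ P)))) → LFVertex (suc m) a
  vertexOn (k , j) p = suc k , j , p

  first-edge : ∀ P → LFEdge (suc m) a (vertexOn P zero) (vertexOn P (suc zero))
  first-edge P = refl , refl , inj₁ refl

  first-edge-distinct : ∀ P → vertexOn P zero ≢ vertexOn P (suc zero)
  first-edge-distinct P ()

  vertexOn-injective : ∀ {P Q p q} → vertexOn P p ≡ vertexOn Q q → P ≡ Q
  vertexOn-injective refl = refl

  different-copies-nonadjacent : ∀ {P Q p q} → P ≢ Q →
    ¬ LFEdge (suc m) a (vertexOn P p) (vertexOn Q q)
  different-copies-nonadjacent P≢Q (k≡k' , j≡j' , _) = P≢Q (Copy-≡ (ℕP.suc-injective k≡k') j≡j')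

  linearForest-¬IsKThreshold-0 : 1 ≤ ∑ m (a ∘ suc) → ¬ IsKThreshold (linearForest (suc m) a) 0
  linearForest-¬IsKThreshold-0 h zero-threshold =
    let P = some-copy m (a ∘ suc) h
    in IsKThreshold-0⇒edgeless zero-threshold (first-edge-distinct P) (first-edge P)

  linearForest-¬IsKThreshold-1 : 2 ≤ ∑ m (a ∘ suc) → ¬ IsKThreshold (linearForest (suc m) a) 1
  linearForest-¬IsKThreshold-1 h one-threshold with two-distinct-copies m (a ∘ suc) h
  ... | P , Q , P≢Q =
    Sum.[ different-copies-nonadjacent P≢Q , different-copies-nonadjacent P≢Q ]
      (IsKThreshold-1⇒2K₂-free one-threshold (first-edge-distinct P) (first-edge-distinct Q)
        (P≢Q ∘ vertexOn-injective) (P≢Q ∘ vertexOn-injective) (first-edge P) (first-edge Q))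

mainTheorem3 : (m : ℕ) (a : Fin (suc m) → ℕ) →
    2 ≤ ∑ m (a ∘ suc) →
    ThresholdNumberIs (linearForest (suc m) a) 2
mainTheorem3 m a h = linearForest-IsKThreshold-2 (suc m) a , below-2
  where
  below-2 : ∀ k → k < 2 → ¬ IsKThreshold (linearForest (suc m) a) k
  below-2 zero          _ = linearForest-¬IsKThreshold-0 (ℕP.≤-trans (s≤s z≤n) h)
  below-2 (suc zero)    _ = linearForest-¬IsKThreshold-1 h
  below-2 (suc (suc _)) (s≤s (s≤s ()))
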